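{- The logic $\mathsf{CK}\oplus C_\Diamond\oplus N_\Diamond$ is a conservative extension of $\mathsf{CK}_\Box$.
   Context: Formulas are built from a countably infinite set of propositional variables by $\varphi ::= p \mid \bot \mid \varphi\wedge\varphi \mid \varphi\vee\varphi \mid \varphi\to\varphi \mid \Box\varphi \mid \Diamond\varphi$. For a set $\mathsf{Ax}$ of formulas, $\mathsf{CK}\oplus\mathsf{Ax}$ is the consequence relation generated by: (Ax) $\Gamma\vdash\varphi$ whenever $\varphi$ is a substitution instance of an axiom of a standard Hilbert axiomatisation of intuitionistic propositional logic, of $\Box(p\to q)\to(\Box p\to\Box q)$, of $\Box(p\to q)\to(\Diamond p\to\Diamond q)$, or of a formula in $\mathsf{Ax}$; (El) $\Gamma\vdash\varphi$ if $\varphi\in\Gamma$; (MP) from $\Gamma\vdash\varphi$ and $\Gamma\vdash\varphi\to\psi$ infer $\Gamma\vdash\psi$; (Nec) from $\emptyset\vdash\varphi$ infer $\Gamma\vdash\Box\varphi$. $C_\Diamond$: $\Diamond(p\vee q)\to\Diamond p\vee\Diamond q$; $N_\Diamond$: $\Diamond\bot\to\bot$. $\mathsf{CK}_\Box$ is the logic over $\Diamond$-free formulas axiomatised by intuitionistic propositional logic, $\Box(p\to q)\to(\Box p\to\Box q)$, modus ponens and necessitation. A logic is a conservative extension of $\mathsf{CK}_\Box$ if a $\Diamond$-free formula is derivable in it iff it is derivable in $\mathsf{CK}_\Box$. -}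

module Defs where

open import Data.Nat using (ℕ)
open import Data.Empty using (⊥)
open import Data.Unit using (⊤)
open import Data.Product using (_×_)
open import Relation.Binary.PropositionalEquality using (_≡_)

infixr 6 _∧_
infixr 5 _∨_
infixr 4 _⇒_

data Form : Set where
  var  : ℕ → Form
  falsum : Form
  _∧_  : Form → Form → Form
  _∨_  : Form → Form → Form
  _⇒_  : Form → Form → Form
  □    : Form → Form
  ◇    : Form → Form

Subst : Set
Subst = ℕ → Form

sub : Subst → Form → Form
sub σ (var n)   = σ n
sub σ falsum    = falsum
sub σ (φ ∧ ψ)   = sub σ φ ∧ sub σ ψ
sub σ (φ ∨ ψ)   = sub σ φ ∨ sub σ ψ
sub σ (φ ⇒ ψ)   = sub σ φ ⇒ sub σ ψ
sub σ (□ φ)     = □ (sub σ φ)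
sub σ (◇ φ)     = ◇ (sub σ φ)

p q r : Form
p = var 0
q = var 1
r = var 2

data IPCAx : Form → Set where
  ax-K    : IPCAx (p ⇒ (q ⇒ p))
  ax-S    : IPCAx ((p ⇒ (q ⇒ r)) ⇒ ((p ⇒ q) ⇒ (p ⇒ r)))
  ax-∧E₁  : IPCAx (p ∧ q ⇒ p)
  ax-∧E₂  : IPCAx (p ∧ q ⇒ q)
  ax-∧I   : IPCAx (p ⇒ (q ⇒ p ∧ q))
  ax-∨I₁  : IPCAx (p ⇒ p ∨ q)
  ax-∨I₂  : IPCAx (q ⇒ p ∨ q)
  ax-∨E   : IPCAx ((p ⇒ r) ⇒ ((q ⇒ r) ⇒ (p ∨ q ⇒ r)))
  ax-⊥E   : IPCAx (falsum ⇒ p)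

data CKAx : Form → Set where
  ipc  : ∀ {φ} → IPCAx φ → CKAx φ
  K□   : CKAx (□ (p ⇒ q) ⇒ (□ p ⇒ □ q))
  K◇   : CKAx (□ (p ⇒ q) ⇒ (◇ p ⇒ ◇ q))

FormSet : Set₁
FormSet = Form → Set

∅ : FormSet
∅ _ = ⊥

data _⊢[_]_ (Γ : FormSet) (Ax : FormSet) : Form → Set where
  ax-ck  : ∀ {ψ} (σ : Subst) → CKAx ψ → Γ ⊢[ Ax ] sub σ ψ
  ax-ext : ∀ {ψ} (σ : Subst) → Ax ψ → Γ ⊢[ Ax ] sub σ ψ
  el     : ∀ {φ} → Γ φ → Γ ⊢[ Ax ] φ
  mp     : ∀ {φ ψ} → Γ ⊢[ Ax ] φ → Γ ⊢[ Ax ] (φ ⇒ ψ) → Γ ⊢[ Ax ] ψ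
  nec    : ∀ {φ} → ∅ ⊢[ Ax ] φ → Γ ⊢[ Ax ] □ φ

data C◇N◇ : Form → Set where
  C◇ : C◇N◇ (◇ (p ∨ q) ⇒ ◇ p ∨ ◇ q)
  N◇ : C◇N◇ (◇ falsum ⇒ falsum)

◇Free : Form → Set
◇Free (var _)  = ⊤
◇Free falsum   = ⊤
◇Free (φ ∧ ψ)  = ◇Free φ × ◇Free ψ
◇Free (φ ∨ ψ)  = ◇Free φ × ◇Free ψ
◇Free (φ ⇒ ψ)  = ◇Free φ × ◇Free ψ
◇Free (□ φ)    = ◇Free φ
◇Free (◇ _)    = ⊥

data CK□⊢_ : Form → Set where
  ax-ipc : ∀ {ψ} (σ : Subst) → (∀ n → ◇Free (σ n)) → IPCAx ψ → CK□⊢ sub σ ψ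
  ax-K□  : (σ : Subst) → (∀ n → ◇Free (σ n)) → CK□⊢ sub σ (□ (p ⇒ q) ⇒ (□ p ⇒ □ q))
  mp     : ∀ {φ ψ} → CK□⊢ φ → CK□⊢ (φ ⇒ ψ) → CK□⊢ ψ
  nec    : ∀ {φ} → CK□⊢ φ → CK□⊢ □ φ

ConservativeOverCK□ : FormSet → Set
ConservativeOverCK□ Ax =
  ∀ φ → ◇Free φ → ((∅ ⊢[ Ax ] φ → CK□⊢ φ) × (CK□⊢ φ → ∅ ⊢[ Ax ] φ))

{-# OPTIONS --safe #-}
-- Reading every ◇φ as ⊥ sends each theorem of CK ⊕ C◇ ⊕ N◇ to a theorem of CK□:
-- the instances of K◇, C◇ and N◇ become trivial consequences of ⊥ → χ, the other
-- axioms and the rules are preserved, and ◇-free formulas are left fixed.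
-- Conversely, CK□ is literally a fragment of CK.
module Submission where

open import Defs
open import Data.Nat using (zero; suc)
open import Data.Unit using (tt)
open import Data.Product using (_,_)
open import Function using (_∘_)
open import Relation.Binary.PropositionalEquality using (_≡_; refl; sym; cong; cong₂; subst)

erase◇ : Form → Form
erase◇ (var n) = var n
erase◇ falsum  = falsum
erase◇ (φ ∧ ψ) = erase◇ φ ∧ erase◇ ψ
erase◇ (φ ∨ ψ) = erase◇ φ ∨ erase◇ ψ
erase◇ (φ ⇒ ψ) = erase◇ φ ⇒ erase◇ ψ
erase◇ (□ φ)   = □ (erase◇ φ)
erase◇ (◇ _)   = falsum

erase◇-◇Free : ∀ φ → ◇Free (erase◇ φ)
erase◇-◇Free (var n) = tt
erase◇-◇Free falsum  = tt
erase◇-◇Free (φ ∧ ψ) = erase◇-◇Free φ , erase◇-◇Free ψ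
erase◇-◇Free (φ ∨ ψ) = erase◇-◇Free φ , erase◇-◇Free ψ
erase◇-◇Free (φ ⇒ ψ) = erase◇-◇Free φ , erase◇-◇Free ψ
erase◇-◇Free (□ φ)   = erase◇-◇Free φ
erase◇-◇Free (◇ φ)   = tt

erase◇-◇Free-id : ∀ φ → ◇Free φ → erase◇ φ ≡ φ
erase◇-◇Free-id (var n) _       = refl
erase◇-◇Free-id falsum  _       = refl
erase◇-◇Free-id (φ ∧ ψ) (f , g) = cong₂ _∧_ (erase◇-◇Free-id φ f) (erase◇-◇Free-id ψ g)
erase◇-◇Free-id (φ ∨ ψ) (f , g) = cong₂ _∨_ (erase◇-◇Free-id φ f) (erase◇-◇Free-id ψ g)
erase◇-◇Free-id (φ ⇒ ψ) (f , g) = cong₂ _⇒_ (erase◇-◇Free-id φ f) (erase◇-◇Free-id ψ g)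
erase◇-◇Free-id (□ φ)   f       = cong □ (erase◇-◇Free-id φ f)

erase◇-sub : ∀ σ φ → ◇Free φ → erase◇ (sub σ φ) ≡ sub (erase◇ ∘ σ) φ
erase◇-sub σ (var n) _       = refl
erase◇-sub σ falsum  _       = refl
erase◇-sub σ (φ ∧ ψ) (f , g) = cong₂ _∧_ (erase◇-sub σ φ f) (erase◇-sub σ ψ g)
erase◇-sub σ (φ ∨ ψ) (f , g) = cong₂ _∨_ (erase◇-sub σ φ f) (erase◇-sub σ ψ g)
erase◇-sub σ (φ ⇒ ψ) (f , g) = cong₂ _⇒_ (erase◇-sub σ φ f) (erase◇-sub σ ψ g)
erase◇-sub σ (□ φ)   f       = cong □ (erase◇-sub σ φ f)

IPCAx-◇Free : ∀ {φ} → IPCAx φ → ◇Free φ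
IPCAx-◇Free ax-K   = _
IPCAx-◇Free ax-S   = _
IPCAx-◇Free ax-∧E₁ = _
IPCAx-◇Free ax-∧E₂ = _
IPCAx-◇Free ax-∧I  = _
IPCAx-◇Free ax-∨I₁ = _
IPCAx-◇Free ax-∨I₂ = _
IPCAx-◇Free ax-∨E  = _
IPCAx-◇Free ax-⊥E  = _

⟨_,_⟩ : Form → Form → Subst
⟨ φ , ψ ⟩ zero          = φ
⟨ φ , ψ ⟩ (suc zero)    = ψ
⟨ φ , ψ ⟩ (suc (suc _)) = falsum

⟨,⟩-◇Free : ∀ {φ ψ} → ◇Free φ → ◇Free ψ → ∀ n → ◇Free (⟨ φ , ψ ⟩ n)
⟨,⟩-◇Free f g zero          = f
⟨,⟩-◇Free f g (suc zero)    = g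
⟨,⟩-◇Free f g (suc (suc _)) = tt

CK□-⊥E : ∀ {φ} → ◇Free φ → CK□⊢ (falsum ⇒ φ)
CK□-⊥E f = ax-ipc ⟨ _ , falsum ⟩ (⟨,⟩-◇Free f tt) ax-⊥E

CK□-weaken : ∀ {φ ψ} → ◇Free φ → ◇Free ψ → CK□⊢ φ → CK□⊢ (ψ ⇒ φ)
CK□-weaken f g ⊢φ = mp ⊢φ (ax-ipc ⟨ _ , _ ⟩ (⟨,⟩-◇Free f g) ax-K)

CK□-IPCAx : ∀ {φ} (σ : Subst) → IPCAx φ → CK□⊢ erase◇ (sub σ φ)
CK□-IPCAx {φ} σ a =
  subst CK□⊢_ (sym (erase◇-sub σ φ (IPCAx-◇Free a)))
        (ax-ipc (erase◇ ∘ σ) (erase◇-◇Free ∘ σ) a)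

ErasesIntoCK□ : FormSet → Set
ErasesIntoCK□ Ax = ∀ {φ} (σ : Subst) → Ax φ → CK□⊢ erase◇ (sub σ φ)

CKAx-erasesIntoCK□ : ErasesIntoCK□ CKAx
CKAx-erasesIntoCK□ σ (ipc a) = CK□-IPCAx σ a
CKAx-erasesIntoCK□ σ K□      = ax-K□ (erase◇ ∘ σ) (erase◇-◇Free ∘ σ)
CKAx-erasesIntoCK□ σ K◇      = CK□-weaken (tt , tt) (erase◇-◇Free (□ (σ 0 ⇒ σ 1))) (CK□-⊥E tt)

C◇N◇-erasesIntoCK□ : ErasesIntoCK□ C◇N◇
C◇N◇-erasesIntoCK□ σ C◇ = CK□-⊥E (tt , tt)
C◇N◇-erasesIntoCK□ σ N◇ = CK□-⊥E tt

erase◇-sound : ∀ {Ax φ} → ErasesIntoCK□ Ax → ∅ ⊢[ Ax ] φ → CK□⊢ erase◇ φ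
erase◇-sound e (ax-ck σ a)  = CKAx-erasesIntoCK□ σ a
erase◇-sound e (ax-ext σ a) = e σ a
erase◇-sound e (mp ⊢φ ⊢φ⇒ψ) = mp (erase◇-sound e ⊢φ) (erase◇-sound e ⊢φ⇒ψ)
erase◇-sound e (nec ⊢φ)     = nec (erase◇-sound e ⊢φ)

CK□⊢⇒⊢ : ∀ {Γ Ax φ} → CK□⊢ φ → Γ ⊢[ Ax ] φ
CK□⊢⇒⊢ (ax-ipc σ _ a)  = ax-ck σ (ipc a)
CK□⊢⇒⊢ (ax-K□ σ _)     = ax-ck σ K□
CK□⊢⇒⊢ (mp ⊢φ ⊢φ⇒ψ)    = mp (CK□⊢⇒⊢ ⊢φ) (CK□⊢⇒⊢ ⊢φ⇒ψ)
CK□⊢⇒⊢ (nec ⊢φ)        = nec (CK□⊢⇒⊢ ⊢φ)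

conservativeOverCK□ : ∀ {Ax} → ErasesIntoCK□ Ax → ConservativeOverCK□ Ax
conservativeOverCK□ e φ f =
  (λ ⊢φ → subst CK□⊢_ (erase◇-◇Free-id φ f) (erase◇-sound e ⊢φ)) , CK□⊢⇒⊢

mainTheorem5 : ConservativeOverCK□ C◇N◇
mainTheorem5 = conservativeOverCK□ C◇N◇-erasesIntoCK□
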